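{- Let $C_n$ be the cycle on $n\ge 3$ vertices. Then $TTr(C_n)=1$ if $n=3$, $TTr(C_n)=2$ if $n\in\{4,5\}$, and $TTr(C_n)=3$ if $n\ge 6$.
   Context: All graphs are finite and simple. For disjoint vertex sets $A,B$, $A$ dominates $B$ if every vertex of $B$ has a neighbour in $A$. A tournament transitive partition of order $k$ of $G=(V,E)$ is a partition $\{V_1,\dots,V_k\}$ of $V$ into nonempty sets such that for all $1\le i<j\le k$, $V_i$ dominates $V_j$ and $V_j$ does not dominate $V_i$. The tournament transitivity $TTr(G)$ is the maximum $k$ for which such a partition exists. -}

module Defs where

open import Data.Nat using (ℕ; zero; suc; _≤_; _<_; _%_; NonZero; s≤s)
open import Data.Nat.Properties using (<-cmp; n<1+n; <-irrefl; <-≤-trans; 1+n≢0)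
open import Data.Nat.DivMod using (n%n≡0; m<n⇒m%n≡m)
open import Data.Fin using (Fin; toℕ)
open import Data.Fin.Properties using (toℕ<n)
open import Data.Product using (Σ; ∃; _×_; _,_)
open import Data.Sum using (_⊎_; inj₁; inj₂; swap)
open import Relation.Binary.PropositionalEquality using (_≡_; refl; trans; cong)
open import Relation.Nullary using (¬_)
open import Level using (0ℓ)
open import Relation.Binary using (Rel; Symmetric; Irreflexive; tri<; tri≈; tri>)

record Graph : Set₁ where
  field
    order     : ℕ
    Adj       : Rel (Fin order) 0ℓ
    Adj-sym   : Symmetric Adj
    Adj-irrefl : Irreflexive _≡_ Adj

open Graph public

CycleAdj : (n : ℕ) → .{{_ : NonZero n}} → Rel (Fin n) 0ℓ
CycleAdj n i j = (toℕ j ≡ suc (toℕ i) % n) ⊎ (toℕ i ≡ suc (toℕ j) % n)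

private
  noloop : ∀ n m → m < suc (suc n) → ¬ (m ≡ suc m % suc (suc n))
  noloop n m m<N eq with <-cmp (suc m) (suc (suc n))
  ... | tri< lt _ _ = <-irrefl (trans eq (m<n⇒m%n≡m lt)) (n<1+n m)
  noloop n zero m<N eq | tri≈ _ () _
  noloop n (suc m) m<N eq | tri≈ _ e _ =
    1+n≢0 (trans eq (trans (cong (_% suc (suc n)) e) (n%n≡0 (suc (suc n)))))
  ... | tri> _ _ gt = <-irrefl refl (<-≤-trans gt m<N)

-- The cycle C_{n+3} (vertex set Fin (n+3), so at least 3 vertices).
Cycle : (n : ℕ) → Graph
Cycle n = record
  { order = suc (suc (suc n))
  ; Adj = CycleAdj (suc (suc (suc n)))
  ; Adj-sym = swap
  ; Adj-irrefl = irr
  }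
  where
    irr : Irreflexive _≡_ (CycleAdj (suc (suc (suc n))))
    irr {i} refl (inj₁ e) = noloop (suc n) (toℕ i) (toℕ<n i) e
    irr {i} refl (inj₂ e) = noloop (suc n) (toℕ i) (toℕ<n i) e

-- A partition {V₁,…,V_k} of V(G) into nonempty classes, labelled in order, is
-- given by a class map p : V → Fin k that is surjective (each class nonempty).
Dominates : (G : Graph) {k : ℕ} → (Fin (order G) → Fin k) → Fin k → Fin k → Set
Dominates G p i j = ∀ v → p v ≡ j → ∃ λ u → p u ≡ i × Adj G u v

IsTTPartition : (G : Graph) (k : ℕ) → (Fin (order G) → Fin k) → Set
IsTTPartition G k p =
  (∀ i → ∃ λ v → p v ≡ i) ×
  (∀ (i j : Fin k) → toℕ i < toℕ j → Dominates G p i j × ¬ Dominates G p j i)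

HasTTPartition : Graph → ℕ → Set
HasTTPartition G k = Σ (Fin (order G) → Fin k) (IsTTPartition G k)

TTr≡ : Graph → ℕ → Set
TTr≡ G t = HasTTPartition G t × (∀ k → HasTTPartition G k → k ≤ t)

{-# OPTIONS --safe #-}
module Submission where

-- A vertex in the fourth class of a tournament transitive partition has a
-- neighbour in each of the first three classes, and in a cycle every vertex has
-- only two neighbours, so the order is at most 3.  On C_n with n ≥ 6 the classes
-- {1, 5}, {2} and the remaining vertices realise order 3.  For n ≤ 5 the orders
-- between the claimed value and 3 are ruled out by exhaustive search.

open import Defs
open import Data.Nat using (ℕ; zero; suc; _+_; _≤_; _<_; _%_; _<?_; z≤n; s≤s)
import Data.Nat as ℕ
open import Data.Nat.Properties using (suc-injective; m≤n⇒m<n∨m≡n)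
open import Data.Nat.DivMod using (n%n≡0; m<n⇒m%n≡m)
open import Data.Fin using (Fin; toℕ; #_) renaming (zero to fzero; suc to fsuc)
import Data.Fin as Fin
open import Data.Fin.Properties using (toℕ-injective; toℕ≤pred[n]; any?; all?)
open import Data.Vec.Functional using ([]; _∷_; head; tail)
open import Data.Vec.Functional.Properties using (∷-cong)
open import Data.Product using (∃; _×_; _,_; proj₁; proj₂)
open import Data.Sum using (_⊎_; inj₁; inj₂)
open import Data.Empty using (⊥-elim)
open import Relation.Binary.PropositionalEquality using (_≡_; _≢_; _≗_; refl; sym; trans; cong)
open import Relation.Nullary using (¬_; Dec)
open import Relation.Nullary.Decidable using (_×-dec_; _→-dec_; _⊎-dec_; ¬?; map′; from-yes; from-no)

suc-%-cases : ∀ {N x} → x ≤ N → (x ≡ N × suc x % suc N ≡ 0) ⊎ suc x % suc N ≡ suc x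
suc-%-cases {N} x≤N with m≤n⇒m<n∨m≡n x≤N
... | inj₁ x<N  = inj₂ (m<n⇒m%n≡m (s≤s x<N))
... | inj₂ refl = inj₁ (refl , n%n≡0 (suc N))

suc-%-injective : ∀ {N x y} → x ≤ N → y ≤ N → suc x % suc N ≡ suc y % suc N → x ≡ y
suc-%-injective x≤N y≤N eq with suc-%-cases x≤N | suc-%-cases y≤N
... | inj₁ (x≡N , _)  | inj₁ (y≡N , _)  = trans x≡N (sym y≡N)
... | inj₁ (_ , wrap) | inj₂ y′          with () ← trans (sym wrap) (trans eq y′)
... | inj₂ x′          | inj₁ (_ , wrap) with () ← trans (sym wrap) (trans (sym eq) x′)
... | inj₂ x′          | inj₂ y′          = suc-injective (trans (sym x′) (trans eq y′))

AtMostTwoNeighbours : Graph → Set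
AtMostTwoNeighbours G =
  ∀ {a b c v} → Adj G a v → Adj G b v → Adj G c v → a ≡ b ⊎ a ≡ c ⊎ b ≡ c

Cycle-atMostTwoNeighbours : ∀ n → AtMostTwoNeighbours (Cycle n)
Cycle-atMostTwoNeighbours n = pigeonhole
  where
  same-predecessor : ∀ {a b : Fin (order (Cycle n))} v →
    toℕ v ≡ suc (toℕ a) % order (Cycle n) → toℕ v ≡ suc (toℕ b) % order (Cycle n) → a ≡ b
  same-predecessor {a} {b} _ va vb =
    toℕ-injective (suc-%-injective (toℕ≤pred[n] a) (toℕ≤pred[n] b) (trans (sym va) vb))

  same-successor : ∀ {a b : Fin (order (Cycle n))} v →
    toℕ a ≡ suc (toℕ v) % order (Cycle n) → toℕ b ≡ suc (toℕ v) % order (Cycle n) → a ≡ b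
  same-successor _ av bv = toℕ-injective (trans av (sym bv))

  pigeonhole : AtMostTwoNeighbours (Cycle n)
  pigeonhole {v = v} (inj₁ a) (inj₁ b) _        = inj₁ (same-predecessor v a b)
  pigeonhole {v = v} (inj₂ a) (inj₂ b) _        = inj₁ (same-successor v a b)
  pigeonhole {v = v} (inj₁ a) (inj₂ _) (inj₁ c) = inj₂ (inj₁ (same-predecessor v a c))
  pigeonhole {v = v} (inj₁ _) (inj₂ b) (inj₂ c) = inj₂ (inj₂ (same-successor v b c))
  pigeonhole {v = v} (inj₂ _) (inj₁ b) (inj₁ c) = inj₂ (inj₂ (same-predecessor v b c))
  pigeonhole {v = v} (inj₂ a) (inj₁ _) (inj₂ c) = inj₂ (inj₁ (same-successor v a c))

-- The case toℕ u ≡ 0 is the edge closing the cycle, from its last vertex w.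
Cycle-neighbour : ∀ {n} {u w : Fin (order (Cycle n))} → Adj (Cycle n) u w → toℕ w ≢ 0 →
  toℕ u ≡ 0 ⊎ suc (toℕ u) ≡ toℕ w ⊎ toℕ u ≡ suc (toℕ w)
Cycle-neighbour {u = u} (inj₁ w≡u+1) w≢0 with suc-%-cases (toℕ≤pred[n] u)
... | inj₁ (_ , wrap) = ⊥-elim (w≢0 (trans w≡u+1 wrap))
... | inj₂ no-wrap    = inj₂ (inj₁ (sym (trans w≡u+1 no-wrap)))
Cycle-neighbour {w = w} (inj₂ u≡w+1) _ with suc-%-cases (toℕ≤pred[n] w)
... | inj₁ (_ , wrap) = inj₁ (trans u≡w+1 wrap)
... | inj₂ no-wrap    = inj₂ (inj₂ (trans u≡w+1 no-wrap))

TTOrders≤ : Graph → ℕ → Set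
TTOrders≤ G t = ∀ k → HasTTPartition G k → k ≤ t

TTOrders≤3 : ∀ G → AtMostTwoNeighbours G → TTOrders≤ G 3
TTOrders≤3 _ _ 0 _ = z≤n
TTOrders≤3 _ _ 1 _ = s≤s z≤n
TTOrders≤3 _ _ 2 _ = s≤s (s≤s z≤n)
TTOrders≤3 _ _ 3 _ = s≤s (s≤s (s≤s z≤n))
TTOrders≤3 _ two (suc (suc (suc (suc _)))) (p , onto , transitive)
  with v , pv ← onto (# 3)
  with a , pa , av ← proj₁ (transitive (# 0) (# 3) (s≤s z≤n)) v pv
     | b , pb , bv ← proj₁ (transitive (# 1) (# 3) (s≤s (s≤s z≤n))) v pv
     | c , pc , cv ← proj₁ (transitive (# 2) (# 3) (s≤s (s≤s (s≤s z≤n)))) v pv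
  with two av bv cv
... | inj₁ refl        with () ← trans (sym pa) pb
... | inj₂ (inj₁ refl) with () ← trans (sym pa) pc
... | inj₂ (inj₂ refl) with () ← trans (sym pb) pc

TTOrders≤-pred : ∀ G {t} → TTOrders≤ G (suc t) → ¬ HasTTPartition G (suc t) → TTOrders≤ G t
TTOrders≤-pred _ bound none k has with m≤n⇒m<n∨m≡n (bound k has)
... | inj₁ (s≤s k≤t) = k≤t
... | inj₂ refl       = ⊥-elim (none has)

oneClassPartition : ∀ G → Fin (order G) → HasTTPartition G 1
oneClassPartition G v = (λ _ → fzero) , (λ { fzero → v , refl }) , λ { fzero fzero () }

module _ (G : Graph) where

  Dominates-resp-≗ : ∀ {k} {p q : Fin (order G) → Fin k} → p ≗ q → ∀ {i j} →
    Dominates G p i j → Dominates G q i j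
  Dominates-resp-≗ p≗q dom v qv with u , pu , uv ← dom v (trans (p≗q v) qv) =
    u , trans (sym (p≗q u)) pu , uv

  IsTTPartition-resp-≗ : ∀ {k} {p q : Fin (order G) → Fin k} → p ≗ q →
    IsTTPartition G k p → IsTTPartition G k q
  IsTTPartition-resp-≗ p≗q (onto , transitive) =
    (λ i → let v , pv = onto i in v , trans (sym (p≗q v)) pv) ,
    λ i j i<j → Dominates-resp-≗ p≗q (proj₁ (transitive i j i<j)) ,
                λ dom → proj₂ (transitive i j i<j) (Dominates-resp-≗ (λ v → sym (p≗q v)) dom)

anyFunction? : ∀ {m k} {P : (Fin m → Fin k) → Set} →
  (∀ {f g} → f ≗ g → P f → P g) → (∀ f → Dec (P f)) → Dec (∃ P)
anyFunction? {zero} {k} resp P? = map′ (empty ,_) (λ (f , Pf) → resp (λ ()) Pf) (P? empty)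
  where
  empty : Fin 0 → Fin k
  empty ()
anyFunction? {suc m} resp P? =
  map′ (λ (x , g , Px∷g) → x ∷ g , Px∷g)
       (λ (f , Pf) → head f , tail f , resp (∷-cong refl (λ _ → refl)) Pf)
       (any? λ x → anyFunction? (λ f≗g → resp (∷-cong refl f≗g)) (λ g → P? (x ∷ g)))

module _ (G : Graph) (adj? : ∀ u v → Dec (Adj G u v)) where

  dominates? : ∀ {k} (p : Fin (order G) → Fin k) i j → Dec (Dominates G p i j)
  dominates? p i j =
    all? λ v → (p v Fin.≟ j) →-dec any? λ u → (p u Fin.≟ i) ×-dec adj? u v

  isTTPartition? : ∀ {k} (p : Fin (order G) → Fin k) → Dec (IsTTPartition G k p)
  isTTPartition? p =
    (all? λ i → any? λ v → p v Fin.≟ i) ×-dec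
    (all? λ i → all? λ j → (toℕ i <? toℕ j) →-dec
      (dominates? p i j ×-dec ¬? (dominates? p j i)))

  hasTTPartition? : ∀ k → Dec (HasTTPartition G k)
  hasTTPartition? _ = anyFunction? (IsTTPartition-resp-≗ G) isTTPartition?

Cycle-adj? : ∀ n u v → Dec (Adj (Cycle n) u v)
Cycle-adj? n u v =
  (toℕ v ℕ.≟ suc (toℕ u) % order (Cycle n)) ⊎-dec
  (toℕ u ℕ.≟ suc (toℕ v) % order (Cycle n))

Cycle-hasTTPartition? : ∀ n k → Dec (HasTTPartition (Cycle n) k)
Cycle-hasTTPartition? n = hasTTPartition? (Cycle n) (Cycle-adj? n)

C₃-noTTPartition2 : ¬ HasTTPartition (Cycle 0) 2
C₃-noTTPartition2 = from-no (Cycle-hasTTPartition? 0 2)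

C₃-noTTPartition3 : ¬ HasTTPartition (Cycle 0) 3
C₃-noTTPartition3 = from-no (Cycle-hasTTPartition? 0 3)

C₄-noTTPartition3 : ¬ HasTTPartition (Cycle 1) 3
C₄-noTTPartition3 = from-no (Cycle-hasTTPartition? 1 3)

C₅-noTTPartition3 : ¬ HasTTPartition (Cycle 2) 3
C₅-noTTPartition3 = from-no (Cycle-hasTTPartition? 2 3)

C₄-TTPartition2 : HasTTPartition (Cycle 1) 2
C₄-TTPartition2 = p , from-yes (isTTPartition? (Cycle 1) (Cycle-adj? 1) p)
  where
  p : Fin 4 → Fin 2
  p = # 0 ∷ # 0 ∷ # 0 ∷ # 1 ∷ []

C₅-TTPartition2 : HasTTPartition (Cycle 2) 2
C₅-TTPartition2 = p , from-yes (isTTPartition? (Cycle 2) (Cycle-adj? 2) p)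
  where
  p : Fin 5 → Fin 2
  p = # 0 ∷ # 0 ∷ # 0 ∷ # 0 ∷ # 1 ∷ []

module CycleOfLengthAtLeast6 (m : ℕ) where

  G : Graph
  G = Cycle (3 + m)

  classOf : ℕ → Fin 3
  classOf 1 = # 1
  classOf 2 = # 2
  classOf 5 = # 1
  classOf _ = # 0

  classOf≡1 : ∀ x → classOf x ≡ # 1 → x ≡ 1 ⊎ x ≡ 5
  classOf≡1 1 _ = inj₁ refl
  classOf≡1 5 _ = inj₂ refl
  classOf≡1 0 ()
  classOf≡1 2 ()
  classOf≡1 3 ()
  classOf≡1 4 ()
  classOf≡1 (suc (suc (suc (suc (suc (suc _)))))) ()

  classOf≡2 : ∀ x → classOf x ≡ # 2 → x ≡ 2
  classOf≡2 2 _ = refl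
  classOf≡2 0 ()
  classOf≡2 1 ()
  classOf≡2 3 ()
  classOf≡2 4 ()
  classOf≡2 5 ()
  classOf≡2 (suc (suc (suc (suc (suc (suc _)))))) ()

  p : Fin (order G) → Fin 3
  p v = classOf (toℕ v)

  dominates01 : Dominates G p (# 0) (# 1)
  dominates01 v pv with classOf≡1 (toℕ v) pv
  ... | inj₁ v≡1 = # 0 , refl , inj₁ v≡1
  ... | inj₂ v≡5 = # 4 , refl , inj₁ v≡5

  dominates02 : Dominates G p (# 0) (# 2)
  dominates02 v pv = # 3 , refl , inj₂ (cong (λ x → suc x % order G) (sym (classOf≡2 (toℕ v) pv)))

  dominates12 : Dominates G p (# 1) (# 2)
  dominates12 v pv = # 1 , refl , inj₁ (classOf≡2 (toℕ v) pv)

  ¬dominates-at : ∀ w {i j} → toℕ w ≢ 0 → p w ≡ i →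
    (∀ x → x ≡ 0 ⊎ suc x ≡ toℕ w ⊎ x ≡ suc (toℕ w) → classOf x ≢ j) →
    ¬ Dominates G p j i
  ¬dominates-at w w≢0 pw avoids dom with u , pu , uw ← dom w pw =
    avoids (toℕ u) (Cycle-neighbour uw w≢0) pu

  ¬dominates10 : ¬ Dominates G p (# 1) (# 0)
  ¬dominates10 = ¬dominates-at (# 3) (λ ()) refl
    λ { _ (inj₁ refl) () ; _ (inj₂ (inj₁ refl)) () ; _ (inj₂ (inj₂ refl)) () }

  ¬dominates20 : ¬ Dominates G p (# 2) (# 0)
  ¬dominates20 = ¬dominates-at (# 4) (λ ()) refl
    λ { _ (inj₁ refl) () ; _ (inj₂ (inj₁ refl)) () ; _ (inj₂ (inj₂ refl)) () }

  ¬dominates21 : ¬ Dominates G p (# 2) (# 1)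
  ¬dominates21 = ¬dominates-at (# 5) (λ ()) refl
    λ { _ (inj₁ refl) () ; _ (inj₂ (inj₁ refl)) () ; _ (inj₂ (inj₂ refl)) () }

  TTPartition3 : HasTTPartition G 3
  TTPartition3 = p , onto , transitive
    where
    onto : ∀ i → ∃ λ v → p v ≡ i
    onto fzero               = # 0 , refl
    onto (fsuc fzero)        = # 1 , refl
    onto (fsuc (fsuc fzero)) = # 2 , refl

    transitive : ∀ i j → toℕ i < toℕ j → Dominates G p i j × ¬ Dominates G p j i
    transitive fzero        (fsuc fzero)        _ = dominates01 , ¬dominates10
    transitive fzero        (fsuc (fsuc fzero)) _ = dominates02 , ¬dominates20
    transitive (fsuc fzero) (fsuc (fsuc fzero)) _ = dominates12 , ¬dominates21
    transitive fzero               fzero               ()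
    transitive (fsuc fzero)        fzero               ()
    transitive (fsuc fzero)        (fsuc fzero)        (s≤s ())
    transitive (fsuc (fsuc fzero)) fzero               ()
    transitive (fsuc (fsuc fzero)) (fsuc fzero)        (s≤s ())
    transitive (fsuc (fsuc fzero)) (fsuc (fsuc fzero)) (s≤s (s≤s ()))

Cycle-TTOrders≤3 : ∀ n → TTOrders≤ (Cycle n) 3
Cycle-TTOrders≤3 n = TTOrders≤3 (Cycle n) (Cycle-atMostTwoNeighbours n)

proposition9 : (TTr≡ (Cycle 0) 1)
    × (TTr≡ (Cycle 1) 2)
    × (TTr≡ (Cycle 2) 2)
    × (∀ n → 3 ≤ n → TTr≡ (Cycle n) 3)
proposition9 =
  (oneClassPartition (Cycle 0) (# 0) ,
   TTOrders≤-pred (Cycle 0) (TTOrders≤-pred (Cycle 0) (Cycle-TTOrders≤3 0) C₃-noTTPartition3)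
     C₃-noTTPartition2) ,
  (C₄-TTPartition2 , TTOrders≤-pred (Cycle 1) (Cycle-TTOrders≤3 1) C₄-noTTPartition3) ,
  (C₅-TTPartition2 , TTOrders≤-pred (Cycle 2) (Cycle-TTOrders≤3 2) C₅-noTTPartition3) ,
  λ { _ (s≤s (s≤s (s≤s {n = m} z≤n))) →
        CycleOfLengthAtLeast6.TTPartition3 m , Cycle-TTOrders≤3 (3 + m) }
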